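{- Let $\mathcal M$ be a map with distinct edge weights and let $(T,C,X)$ be a tree-cotree decomposition. Form $T'$ from $T$ by repeatedly applying the following steps until neither applies: if the current tree has a degree-one vertex that is not an endpoint of an edge of $X$, delete that vertex and its incident edge; otherwise, if it has a degree-two vertex that is not an endpoint of an edge of $X$, with incident edges $e,e'$, contract whichever of $e,e'$ has smaller weight (the other edge keeps its weight). Form $C'$ from the dual tree $C^*=\{e^*:e\in C\}$ in the same way with respect to the endpoints of the dual edges $X^*=\{e^*:e\in X\}$, except that at a degree-two vertex the edge of larger weight is contracted. Then $T'$ and $C'$ have $O(|X|)$ edges, and they do not depend on the order in which the deletions and contractions are performed.
   Context: A map is a connected graph embedded in a closed 2-manifold so that every face is an open disk; the dual map has a vertex per face and a dual edge $e^*$ for each edge $e$ (with the same weight). A spanning cotree is a set $C$ of edges whose duals form a spanning tree of the dual map. A tree-cotree decomposition is a triple $(T,C,X)$ of pairwise disjoint edge sets whose union is the edge set, with $T$ a spanning tree and $C$ a spanning cotree. -}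

module Defs where

open import Level using (0ℓ)
open import Data.Nat using (ℕ; _*_; _≤_)
open import Data.Bool using (Bool; true; false; if_then_else_)
open import Data.Fin using (Fin; _≟_)
open import Data.Fin.Subset using (Subset; _∈_; _∉_; ∣_∣)
open import Data.Vec using (Vec; lookup; tabulate)
open import Data.List using (List; []; _∷_; length)
import Data.List as List
open import Data.List.Relation.Unary.Unique.Propositional using (Unique)
open import Data.Product using (Σ; ∃; ∃-syntax; _×_; _,_; proj₁)
open import Data.Sum using (_⊎_)
open import Data.Empty using (⊥)
open import Relation.Nullary using (¬_; does)
open import Relation.Binary.PropositionalEquality using (_≡_; _≢_)
open import Relation.Binary.Construct.Closure.ReflexiveTransitive using (Star)
open import Relation.Binary.Bundles using (StrictTotalOrder)

_⇔_ : Set → Set → Set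
A ⇔ B = (A → B) × (B → A)

-- Finite multigraphs given by endpoint functions (loops / parallel edges
-- allowed).  Vertices Fin nV, edges Fin nE, edge e joins src e and tgt e.

module Graph {nV nE : ℕ} (src tgt : Fin nE → Fin nV) where

  Joins : Fin nE → Fin nV → Fin nV → Set
  Joins e u v = (src e ≡ u × tgt e ≡ v) ⊎ (src e ≡ v × tgt e ≡ u)

  data Walk (S : Subset nE) : Fin nV → Fin nV → Set where
    [] : ∀ {v} → Walk S v v
    _∷_ : ∀ {u v w} → (Σ (Fin nE) λ e → e ∈ S × Joins e u v) → Walk S v w → Walk S u w

  edges : ∀ {S u v} → Walk S u v → List (Fin nE)
  edges [] = []
  edges ((e , _) ∷ p) = e ∷ edges p

  Connected : Subset nE → Set
  Connected S = ∀ u v → Walk S u v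

  Acyclic : Subset nE → Set
  Acyclic S = ∀ v (p : Walk S v v) → Unique (edges p) → edges p ≡ []

  SpanningTree : Subset nE → Set
  SpanningTree S = Connected S × Acyclic S

  -- The reduction process on a tree.
  -- A state records, for every edge, whether it is still present (live),
  -- removed (dead: deleted, or never part of the tree), or contracted.

  data St : Set where
    live dead contr : St

  State : Set
  State = Fin nE → St

  isLive : St → Bool
  isLive live = true
  isLive dead = false
  isLive contr = false

  upd : State → Fin nE → St → State
  upd s e x e' = if does (e' ≟ e) then x else s e'

  init : Subset nE → State
  init S e = if lookup S e then live else dead

  liveSet : State → Subset nE
  liveSet s = tabulate (λ e → isLive (s e))

  -- u and w are identified (lie in the same vertex of the current,
  -- contracted graph)
  data Same (s : State) : Fin nV → Fin nV → Set where
    here : ∀ {u} → Same s u u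
    via  : ∀ {u v w} e → s e ≡ contr → Joins e u v → Same s v w → Same s u w

  Live : State → Fin nE → Set
  Live s e = s e ≡ live

  Inc : State → Fin nV → Fin nE → Set
  Inc s u e = Same s u (src e) ⊎ Same s u (tgt e)

  TermV : (Term : Fin nV → Set) → State → Fin nV → Set
  TermV Term s u = ∃[ v ] (Same s u v × Term v)

  Deg1 : State → Fin nV → Fin nE → Set
  Deg1 s u e = Live s e × Inc s u e × (∀ e′ → Live s e′ → Inc s u e′ → e′ ≡ e)

  Deg2 : State → Fin nV → Fin nE → Fin nE → Set
  Deg2 s u e e′ = e ≢ e′ × Live s e × Live s e′ × Inc s u e × Inc s u e′
                × (∀ e″ → Live s e″ → Inc s u e″ → e″ ≡ e ⊎ e″ ≡ e′)

  -- One step.  `Term` marks the terminal vertices; `Contract e e′` says that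
  -- of the two edges at a degree-two vertex, e (not e′) is the one contracted.
  -- Contractions happen only when no deletion applies ("otherwise").
  data Step (Term : Fin nV → Set) (Contract : Fin nE → Fin nE → Set)
            (s : State) : State → Set where
    delete   : ∀ u e → Deg1 s u e → ¬ TermV Term s u → Step Term Contract s (upd s e dead)
    contract : ∀ u e e′ → Deg2 s u e e′ → ¬ TermV Term s u → Contract e e′
             → (∀ u′ e″ → Deg1 s u′ e″ → TermV Term s u′)
             → Step Term Contract s (upd s e contr)

  Reduces : (Term : Fin nV → Set) (Contract : Fin nE → Fin nE → Set)
          → Subset nE → State → Set
  Reduces Term Contract S s =
    Star (Step Term Contract) (init S) s × (∀ s′ → ¬ Step Term Contract s s′)

  -- two final states describe the same graph: same surviving edges, and the
  -- same identifications among the endpoints of surviving edges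
  End : Bool → Fin nE → Fin nV
  End b e = if b then src e else tgt e

  SameResult : State → State → Set
  SameResult s s′ =
    (∀ e → Live s e ⇔ Live s′ e)
    × (∀ e f → Live s e → Live s f → ∀ b c →
         Same s (End b e) (End c f) ⇔ Same s′ (End b e) (End c f))

data Orbit {n : ℕ} (gs : List (Fin n → Fin n)) : Fin n → Fin n → Set where
  here  : ∀ {f} → Orbit gs f f
  there : ∀ {f g} (i : Fin (length gs)) → Orbit gs (List.lookup gs i f) g → Orbit gs f g

-- Maps on closed surfaces (orientable or not), as graph-encoded maps:
-- flags with three fixed-point-free involutions α₀ (change vertex),
-- α₁ (change edge), α₂ (change face), α₀α₂ = α₂α₀ a fixed-point-free
-- involution, and the generated group transitive (connectedness).
-- Vertices / edges / faces are the orbits of ⟨α₁,α₂⟩ / ⟨α₀,α₂⟩ / ⟨α₀,α₁⟩;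
-- they are given as finite sets together with the orbit-classifying maps.

record Map : Set where
  field
    nFl nV nE nF : ℕ
    α₀ α₁ α₂ : Fin nFl → Fin nFl
    α₀-inv : ∀ x → α₀ (α₀ x) ≡ x
    α₁-inv : ∀ x → α₁ (α₁ x) ≡ x
    α₂-inv : ∀ x → α₂ (α₂ x) ≡ x
    α₀-fpf : ∀ x → α₀ x ≢ x
    α₁-fpf : ∀ x → α₁ x ≢ x
    α₂-fpf : ∀ x → α₂ x ≢ x
    α₀α₂-comm : ∀ x → α₀ (α₂ x) ≡ α₂ (α₀ x)
    α₀α₂-fpf : ∀ x → α₀ (α₂ x) ≢ x
    connected : ∀ x y → Orbit (α₀ ∷ α₁ ∷ α₂ ∷ []) x y
    vert : Fin nFl → Fin nV
    edge : Fin nFl → Fin nE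
    face : Fin nFl → Fin nF
    vert-orbit : ∀ x y → (vert x ≡ vert y) ⇔ Orbit (α₁ ∷ α₂ ∷ []) x y
    edge-orbit : ∀ x y → (edge x ≡ edge y) ⇔ Orbit (α₀ ∷ α₂ ∷ []) x y
    face-orbit : ∀ x y → (face x ≡ face y) ⇔ Orbit (α₀ ∷ α₁ ∷ []) x y
    vert-surj : ∀ v → Σ (Fin nFl) λ x → vert x ≡ v
    edge-surj : ∀ e → Σ (Fin nFl) λ x → edge x ≡ e
    face-surj : ∀ f → Σ (Fin nFl) λ x → face x ≡ f

  rep : Fin nE → Fin nFl
  rep e = proj₁ (edge-surj e)

  src tgt : Fin nE → Fin nV
  src e = vert (rep e)
  tgt e = vert (α₀ (rep e))

  dsrc dtgt : Fin nE → Fin nF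
  dsrc e = face (rep e)
  dtgt e = face (α₂ (rep e))

  module Primal = Graph src tgt
  module Dual   = Graph dsrc dtgt

  TreeCotree : Subset nE → Subset nE → Subset nE → Set
  TreeCotree T C X =
    (∀ e → e ∈ T ⊎ e ∈ C ⊎ e ∈ X)
    × (∀ e → e ∈ T → e ∈ C → ⊥)
    × (∀ e → e ∈ T → e ∈ X → ⊥)
    × (∀ e → e ∈ C → e ∈ X → ⊥)
    × Primal.SpanningTree T
    × Dual.SpanningTree C

  TermPrimal : Subset nE → Fin nV → Set
  TermPrimal X v = ∃[ e ] (e ∈ X × (src e ≡ v ⊎ tgt e ≡ v))

  TermDual : Subset nE → Fin nF → Set
  TermDual X φ = ∃[ e ] (e ∈ X × (dsrc e ≡ φ ⊎ dtgt e ≡ φ))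

{-# OPTIONS --safe #-}
-- The states of either reduction are forests whose edges are live, deleted or
-- contracted; the vertices of the current graph are the classes of Same.
--
-- Two different steps from one state can each be followed by one more
-- step so that both reach the same state: deletions and contractions at different
-- vertices do not interfere, a deletion (of a non-terminal leaf) and a contraction
-- are never applicable together, and if e is contracted in preference to e′ at one
-- end of e′ while e′ is contracted in preference to f′ at its other end, contracting
-- e′ and then e (now preferred to f′ by transitivity) gives the same result as
-- contracting e and then e′. By this diamond property the final state is unique.
--
-- In a final state every class of degree one or two is terminal, so the V
-- non-isolated classes satisfy 3V ≤ (sum of degrees) + 2t ≤ 2L + 2t, where L counts
-- the live edges and t the terminal classes; t ≤ 2|X| since each terminal class
-- contains one of the at most 2|X| endpoints of edges of X. Contracting the live
-- edges of a forest one at a time merges two classes at each step, so V ≥ L, and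
-- therefore L ≤ 4|X|.
module Submission where

open import Defs
open import Level using (Level; 0ℓ)
open import Data.Nat using (ℕ; zero; suc; _+_; _*_; _≤_; z≤n; s≤s)
import Data.Nat as ℕ
import Data.Nat.Properties as ℕₚ
open import Data.Bool using (true; false; if_then_else_)
open import Data.Fin using (Fin; zero; suc; _≟_)
import Data.Fin as Fin
import Data.Fin.Properties as Finₚ
open import Data.Fin.Subset using (Subset; _∈_; ∣_∣)
open import Data.Fin.Subset.Properties using (_∈?_)
open import Data.Vec using ([]; _∷_; lookup)
open import Data.Vec.Properties using (lookup⇒[]=; []=⇒lookup; lookup∘tabulate)
open import Data.List using (List; []; _∷_; allFin)
open import Data.Product using (Σ; ∃-syntax; ∃₂; _×_; _,_; proj₁; proj₂)
import Data.Product as Product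
open import Data.Sum using (_⊎_; inj₁; inj₂)
import Data.Sum as Sum
open import Data.Empty using (⊥; ⊥-elim)
open import Function using (_∘_; flip)
open import Relation.Nullary using (¬_; Dec; yes; no; does; contradiction)
open import Relation.Nullary.Decidable using (map′; _×-dec_; _⊎-dec_; ¬?)
open import Relation.Unary using (Pred)
open import Relation.Binary.Core using (Rel)
open import Relation.Binary.Definitions using (Asymmetric; Transitive; tri<; tri≈; tri>)
open import Relation.Binary.Structures using (IsEquivalence)
open import Relation.Binary.PropositionalEquality
  using (_≡_; _≢_; refl; sym; trans; subst; subst₂; cong; cong₂)
open import Relation.Binary.Construct.Closure.ReflexiveTransitive using (Star; ε; _◅_)
open import Relation.Binary.Rewriting using (IsNormalForm)
open import Relation.Binary.Bundles using (StrictTotalOrder)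
open StrictTotalOrder using (Carrier; _≈_; _<_)
open Map using (nE; TreeCotree; TermPrimal; TermDual; module Primal; module Dual)

module Counting where

  open import Data.Nat.Properties
    using ( +-mono-≤; ≤-refl; ≤-reflexive; ≤-trans; m≤m+n; m≤n+m; +-suc; *-identityʳ; suc-injective
          ; +-*-semiring)
  open import Algebra.Properties.Semiring.Sum +-*-semiring
    using (sum; sum-cong-≗; sum-replicate-zero; ∑-distrib-+)

  𝟙 : {P : Set} → Dec P → ℕ
  𝟙 d = if does d then 1 else 0

  count : ∀ {n} {P : Fin n → Set} → (∀ i → Dec (P i)) → ℕ
  count P? = sum (λ i → 𝟙 (P? i))

  sum-mono-≤ : ∀ {n} {f g : Fin n → ℕ} → (∀ i → f i ≤ g i) → sum f ≤ sum g
  sum-mono-≤ {zero}  f≤g = z≤n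
  sum-mono-≤ {suc n} f≤g = +-mono-≤ (f≤g zero) (sum-mono-≤ (f≤g ∘ suc))

  term≤sum : ∀ {n} (f : Fin n → ℕ) i → f i ≤ sum f
  term≤sum f zero    = m≤m+n (f zero) _
  term≤sum f (suc i) = ≤-trans (term≤sum (f ∘ suc) i) (m≤n+m _ (f zero))

  𝟙-yes : {P : Set} (d : Dec P) → P → 𝟙 d ≡ 1
  𝟙-yes (yes _) _ = refl
  𝟙-yes (no ¬p) p = contradiction p ¬p

  𝟙-no : {P : Set} (d : Dec P) → ¬ P → 𝟙 d ≡ 0
  𝟙-no (yes p) ¬p = contradiction p ¬p
  𝟙-no (no _)  _  = refl

  𝟙-mono : {P Q : Set} → (P → Q) → (d : Dec P) (e : Dec Q) → 𝟙 d ≤ 𝟙 e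
  𝟙-mono P⇒Q (yes p) e     = ≤-reflexive (sym (𝟙-yes e (P⇒Q p)))
  𝟙-mono P⇒Q (no _)  e     = z≤n

  𝟙-cong : {P Q : Set} → P ⇔ Q → (d : Dec P) (e : Dec Q) → 𝟙 d ≡ 𝟙 e
  𝟙-cong (P⇒Q , Q⇒P) (yes p) e      = sym (𝟙-yes e (P⇒Q p))
  𝟙-cong (P⇒Q , Q⇒P) (no ¬p) (yes q) = contradiction (Q⇒P q) ¬p
  𝟙-cong (P⇒Q , Q⇒P) (no _)  (no _)  = refl

  𝟙-⊎ : {P Q : Set} (d : Dec P) (e : Dec Q) → 𝟙 (d ⊎-dec e) ≤ 𝟙 d + 𝟙 e
  𝟙-⊎ (yes _) e = s≤s z≤n
  𝟙-⊎ (no _)  e = ≤-refl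

  module _ {n : ℕ} {P Q : Fin n → Set} (P? : ∀ i → Dec (P i)) (Q? : ∀ i → Dec (Q i)) where

    count-mono : (∀ i → P i → Q i) → count P? ≤ count Q?
    count-mono P⊆Q = sum-mono-≤ (λ i → 𝟙-mono (P⊆Q i) (P? i) (Q? i))

    count-cong : (∀ i → P i ⇔ Q i) → count P? ≡ count Q?
    count-cong P⇔Q = sum-cong-≗ (λ i → 𝟙-cong (P⇔Q i) (P? i) (Q? i))

    count-∪ : count (λ i → P? i ⊎-dec Q? i) ≤ count P? + count Q?
    count-∪ = ≤-trans (sum-mono-≤ (λ i → 𝟙-⊎ (P? i) (Q? i)))
                      (≤-reflexive (∑-distrib-+ (λ i → 𝟙 (P? i)) (λ i → 𝟙 (Q? i))))

    count-split : count P? ≡ count (λ i → P? i ×-dec Q? i) + count (λ i → P? i ×-dec ¬? (Q? i))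
    count-split = trans (sum-cong-≗ (λ i → split (P? i) (Q? i)))
                        (∑-distrib-+ (λ i → 𝟙 (P? i ×-dec Q? i)) (λ i → 𝟙 (P? i ×-dec ¬? (Q? i))))
      where
      split : ∀ {A B : Set} (a : Dec A) (b : Dec B) → 𝟙 a ≡ 𝟙 (a ×-dec b) + 𝟙 (a ×-dec ¬? b)
      split (yes _) (yes _) = refl
      split (yes _) (no _)  = refl
      split (no _)  _       = refl

  count-singleton : ∀ {n} (i : Fin n) → count (_≟ i) ≡ 1
  count-singleton {suc n} zero    = cong suc (sum-replicate-zero n)
  count-singleton         (suc i) = count-singleton i

  module _ {n : ℕ} {P : Fin n → Set} (P? : ∀ i → Dec (P i)) where

    count-empty : (∀ i → ¬ P i) → count P? ≡ 0
    count-empty ∄ = trans (sum-cong-≗ (λ i → 𝟙-no (P? i) (∄ i))) (sum-replicate-zero n)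

    count-pos : ∀ i → P i → 1 ≤ count P?
    count-pos i p = ≤-trans (≤-reflexive (sym (𝟙-yes (P? i) p))) (term≤sum (λ i → 𝟙 (P? i)) i)

    count≡0⇒¬ : count P? ≡ 0 → ∀ i → ¬ P i
    count≡0⇒¬ count≡0 i p = contradiction (subst (1 ≤_) count≡0 (count-pos i p)) λ ()

    count-witness : ∀ {k} → count P? ≡ suc k → ∃[ i ] P i
    count-witness count≡suc with Finₚ.any? P?
    ... | yes ∃P = ∃P
    ... | no  ∄P = contradiction (trans (sym count≡suc) (count-empty (λ i p → ∄P (i , p)))) λ ()

    count≤1 : (∀ i j → P i → P j → i ≡ j) → count P? ≤ 1
    count≤1 unique with Finₚ.any? P?
    ... | no  ∄P = ≤-trans (≤-reflexive (count-empty (λ i p → ∄P (i , p)))) z≤n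
    ... | yes (i , p) = ≤-trans (count-mono P? (λ j → j ≟ i) (λ j q → unique j i q p))
                                (≤-reflexive (count-singleton i))

    count-guarded : {A : Set} (A? : Dec A) {k : ℕ} →
                    (∀ i → P i → A) → (A → count P? ≤ k) → count P? ≤ k * 𝟙 A?
    count-guarded (yes a) {k} _   bound = ≤-trans (bound a) (≤-reflexive (sym (*-identityʳ k)))
    count-guarded (no ¬a)     P⇒A _     = ≤-trans (≤-reflexive (count-empty (λ i p → ¬a (P⇒A i p)))) z≤n

  𝟙≤count : ∀ {n} {A : Set} {P : Fin n → Set} (A? : Dec A) (P? : ∀ i → Dec (P i)) →
            (A → ∃[ i ] P i) → 𝟙 A? ≤ count P?
  𝟙≤count (yes a) P? witness = let (i , p) = witness a in count-pos P? i p
  𝟙≤count (no _)  P? _       = z≤n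

  count-add : ∀ {n} {P Q : Fin n → Set} (P? : ∀ i → Dec (P i)) (Q? : ∀ i → Dec (Q i)) x →
              (∀ i → i ≢ x → P i ⇔ Q i) → ¬ P x → Q x → count Q? ≡ suc (count P?)
  count-add {suc n} P? Q? zero    agree ¬Px Qx
    rewrite 𝟙-no (P? zero) ¬Px | 𝟙-yes (Q? zero) Qx =
    cong suc (sum-cong-≗ (λ i → sym (𝟙-cong (agree (suc i) λ ()) (P? (suc i)) (Q? (suc i)))))
  count-add {suc n} P? Q? (suc x) agree ¬Px Qx =
    trans (cong₂ _+_ (sym (𝟙-cong (agree zero λ ()) (P? zero) (Q? zero)))
                     (count-add (P? ∘ suc) (Q? ∘ suc) x
                                (λ i i≢x → agree (suc i) (i≢x ∘ Finₚ.suc-injective)) ¬Px Qx))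
          (+-suc (𝟙 (P? zero)) _)

  module _ {n : ℕ} {P : Fin n → Set} (P? : ∀ i → Dec (P i)) where

    count-remove : ∀ x → P x → count P? ≡ suc (count (λ i → P? i ×-dec ¬? (i ≟ x)))
    count-remove x Px = count-add (λ i → P? i ×-dec ¬? (i ≟ x)) P? x (λ i i≢x → proj₁ , (_, i≢x))
                                  (λ (_ , x≢x) → x≢x refl) Px

    count≡1⇒ : count P? ≡ 1 → ∃[ x ] P x × (∀ y → P y → y ≡ x)
    count≡1⇒ count≡1 with count-witness P? count≡1
    ... | x , Px = x , Px , only
      where
      only : ∀ y → P y → y ≡ x
      only y Py with y ≟ x
      ... | yes y≡x = y≡x
      ... | no  y≢x = contradiction (Py , y≢x) (count≡0⇒¬ (λ i → P? i ×-dec ¬? (i ≟ x))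
                        (suc-injective (trans (sym (count-remove x Px)) count≡1)) y)

  module _ {n : ℕ} {P : Fin n → Set} (P? : ∀ i → Dec (P i)) where

    count≡2⇒ : count P? ≡ 2 → ∃₂ λ x y → x ≢ y × P x × P y × (∀ z → P z → z ≡ x ⊎ z ≡ y)
    count≡2⇒ count≡2 with count-witness P? count≡2
    ... | x , Px with count≡1⇒ (λ i → P? i ×-dec ¬? (i ≟ x))
                               (suc-injective (trans (sym (count-remove P? x Px)) count≡2))
    ...   | y , (Py , y≢x) , only = x , y , (λ x≡y → y≢x (sym x≡y)) , Px , Py , other
      where
      other : ∀ z → P z → z ≡ x ⊎ z ≡ y
      other z Pz with z ≟ x
      ... | yes z≡x = inj₁ z≡x
      ... | no  z≢x = inj₂ (only z (Pz , z≢x))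

  ∣p∣≡count : ∀ {n} (p : Subset n) → ∣ p ∣ ≡ count (_∈? p)
  ∣p∣≡count []          = refl
  ∣p∣≡count (true ∷ p)  = cong suc (∣p∣≡count p)
  ∣p∣≡count (false ∷ p) = ∣p∣≡count p

module UniqueNormalForm
  {a ℓ r p : Level} {A : Set a}
  (_∼_ : Rel A ℓ) (∼-isEquivalence : IsEquivalence _∼_)
  (_⟶_ : Rel A r) (Good : Pred A p)
  (Good-⟶ : ∀ {x y} → Good x → x ⟶ y → Good y)
  (⟶-resp-∼ : ∀ {x x′ y} → x ∼ x′ → x ⟶ y → ∃[ y′ ] x′ ⟶ y′ × y ∼ y′)
  (diamond : ∀ {x y z} → Good x → x ⟶ y → x ⟶ z →
             y ∼ z ⊎ ∃₂ λ y′ z′ → y ⟶ y′ × z ⟶ z′ × y′ ∼ z′)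
  where

  open IsEquivalence ∼-isEquivalence renaming (refl to ∼-refl; sym to ∼-sym; trans to ∼-trans)

  _—↠_ : Rel A _
  _—↠_ = Star _⟶_

  —↠-resp-∼ : ∀ {x x′ m} → x ∼ x′ → x —↠ m → ∃[ m′ ] x′ —↠ m′ × m ∼ m′
  —↠-resp-∼ x∼x′ ε = _ , ε , x∼x′
  —↠-resp-∼ x∼x′ (x⟶y ◅ y↠m) with ⟶-resp-∼ x∼x′ x⟶y
  ... | y′ , x′⟶y′ , y∼y′ with —↠-resp-∼ y∼y′ y↠m
  ...   | m′ , y′↠m′ , m∼m′ = m′ , x′⟶y′ ◅ y′↠m′ , m∼m′

  IsNormalForm-resp-∼ : ∀ {x x′} → x ∼ x′ → IsNormalForm _⟶_ x → IsNormalForm _⟶_ x′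
  IsNormalForm-resp-∼ x∼x′ nf (_ , x′⟶y′) with ⟶-resp-∼ (∼-sym x∼x′) x′⟶y′
  ... | y , x⟶y , _ = nf (y , x⟶y)

  strip : ∀ {x y m} → Good x → x ⟶ y → x —↠ m → IsNormalForm _⟶_ m →
          ∃[ m′ ] y —↠ m′ × m ∼ m′
  strip good x⟶y ε           nf = contradiction (_ , x⟶y) nf
  strip good x⟶y (x⟶z ◅ z↠m) nf with diamond good x⟶z x⟶y
  ... | inj₁ z∼y = —↠-resp-∼ z∼y z↠m
  ... | inj₂ (z′ , y′ , z⟶z′ , y⟶y′ , z′∼y′) with strip (Good-⟶ good x⟶z) z⟶z′ z↠m nf
  ...   | m₁ , z′↠m₁ , m∼m₁ with —↠-resp-∼ z′∼y′ z′↠m₁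
  ...     | m₂ , y′↠m₂ , m₁∼m₂ = m₂ , y⟶y′ ◅ y′↠m₂ , ∼-trans m∼m₁ m₁∼m₂

  normalForm-unique : ∀ {x m m′} → Good x → x —↠ m → IsNormalForm _⟶_ m →
                      x —↠ m′ → IsNormalForm _⟶_ m′ → m ∼ m′
  normalForm-unique good ε           nf ε             nf′ = ∼-refl
  normalForm-unique good (x⟶y ◅ _)   nf ε             nf′ = contradiction (_ , x⟶y) nf′
  normalForm-unique good x↠m         nf (x⟶y ◅ y↠m′) nf′ with strip good x⟶y x↠m nf
  ... | m₁ , y↠m₁ , m∼m₁ =
    ∼-trans m∼m₁ (normalForm-unique (Good-⟶ good x⟶y) y↠m₁ (IsNormalForm-resp-∼ m∼m₁ nf) y↠m′ nf′)

module Contraction {nV nE : ℕ} (src tgt : Fin nE → Fin nV) where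

  open Graph src tgt
  open Counting using (count; count-add)
  open import Data.Fin.Induction using (<-wellFounded)
  open import Induction.WellFounded using (Acc; acc)
  open import Data.List.Membership.Propositional using () renaming (_∈_ to _∈ˡ_)
  open import Data.List.Membership.Propositional.Properties using (∈-allFin)
  open import Data.List.Membership.DecPropositional (_≟_ {nV}) using () renaming (_∈?_ to _∈ˡ?_)
  open import Data.List.Relation.Unary.Any using (here; there)
  open import Data.List.Relation.Unary.All using ([]; _∷_)
  open import Data.List.Relation.Unary.All.Properties using (¬Any⇒All¬; All¬⇒¬Any)
  open import Data.List.Relation.Unary.AllPairs using ([]; _∷_)
  open import Data.List.Relation.Unary.Unique.Propositional using (Unique)

  _⊑_ : State → State → Set
  s ⊑ t = ∀ e → s e ≡ contr → t e ≡ contr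

  -- States are functions, so the diamond property only holds up to pointwise equality.
  _≋_ : State → State → Set
  s ≋ t = ∀ e → s e ≡ t e

  ≋-isEquivalence : IsEquivalence _≋_
  ≋-isEquivalence = record
    { refl  = λ _ → refl
    ; sym   = λ s≋t e → sym (s≋t e)
    ; trans = λ s≋t t≋r e → trans (s≋t e) (t≋r e)
    }

  open IsEquivalence ≋-isEquivalence public using () renaming (sym to ≋-sym)

  ≋⇒⊑ : ∀ {s t} → s ≋ t → s ⊑ t
  ≋⇒⊑ s≋t e = trans (sym (s≋t e))

  upd-≡ : ∀ s e x → upd s e x e ≡ x
  upd-≡ s e x with e ≟ e
  ... | yes _   = refl
  ... | no  e≢e = contradiction refl e≢e

  upd-≢ : ∀ s e x {g} → g ≢ e → upd s e x g ≡ s g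
  upd-≢ s e x {g} g≢e with g ≟ e
  ... | yes g≡e = contradiction g≡e g≢e
  ... | no  _   = refl

  upd-≋ : ∀ {s t} e x → s ≋ t → upd s e x ≋ upd t e x
  upd-≋ e x s≋t g with g ≟ e
  ... | yes _ = refl
  ... | no  _ = s≋t g

  upd-comm : ∀ s {e f} x y → e ≢ f → upd (upd s e x) f y ≋ upd (upd s f y) e x
  upd-comm s {e} {f} x y e≢f g with g ≟ e | g ≟ f
  ... | yes refl | yes refl = contradiction refl e≢f
  ... | yes refl | no  _    = refl
  ... | no  _    | yes refl = refl
  ... | no  _    | no  _    = refl

  upd-Live⁻ : ∀ s e {x g} → x ≢ live → Live (upd s e x) g → g ≢ e × Live s g
  upd-Live⁻ s e {x} {g} x≢live live-g with g ≟ e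
  ... | yes _ = contradiction live-g x≢live
  ... | no  g≢e = g≢e , live-g

  upd-Live⁺ : ∀ s e {x g} → g ≢ e → Live s g → Live (upd s e x) g
  upd-Live⁺ s e {x} g≢e live-g = trans (upd-≢ s e x g≢e) live-g

  live⇒≢contr : ∀ {x} → x ≡ live → x ≢ contr
  live⇒≢contr refl ()

  live⇒≢dead : ∀ {x} → x ≡ live → x ≢ dead
  live⇒≢dead refl ()

  contr⇒≢dead : ∀ {x} → x ≡ contr → x ≢ dead
  contr⇒≢dead refl ()

  ⊑-upd-contr : ∀ s e → s ⊑ upd s e contr
  ⊑-upd-contr s e g s-g with g ≟ e
  ... | yes _ = refl
  ... | no  _ = s-g

  upd-dead-⊑ : ∀ s e → upd s e dead ⊑ s
  upd-dead-⊑ s e g s-g with g ≟ e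
  ... | yes _ = contradiction s-g λ ()
  ... | no  _ = s-g

  ⊑-upd-dead : ∀ {s e} → s e ≢ contr → s ⊑ upd s e dead
  ⊑-upd-dead {s} {e} s-e g s-g with g ≟ e
  ... | yes refl = contradiction s-g s-e
  ... | no  _    = s-g

  Same-trans : ∀ {s u v w} → Same s u v → Same s v w → Same s u w
  Same-trans here          q = q
  Same-trans (via e c j p) q = via e c j (Same-trans p q)

  Joins-sym : ∀ {e u v} → Joins e u v → Joins e v u
  Joins-sym (inj₁ ends) = inj₂ ends
  Joins-sym (inj₂ ends) = inj₁ ends

  Same-sym : ∀ {s u v} → Same s u v → Same s v u
  Same-sym here          = here
  Same-sym (via e c j p) = Same-trans (Same-sym p) (via e c (Joins-sym j) here)

  Same-mono : ∀ {s t} → s ⊑ t → ∀ {u v} → Same s u v → Same t u v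
  Same-mono s⊑t here          = here
  Same-mono s⊑t (via e c j p) = via e (s⊑t e c) j (Same-mono s⊑t p)

  Inc-mono : ∀ {s t} → s ⊑ t → ∀ {u e} → Inc s u e → Inc t u e
  Inc-mono s⊑t = Sum.map (Same-mono s⊑t) (Same-mono s⊑t)

  Inc-Same : ∀ {s u v e} → Same s u v → Inc s v e → Inc s u e
  Inc-Same u~v = Sum.map (Same-trans u~v) (Same-trans u~v)

  Joins⇒Inc : ∀ {s e u v} → Joins e u v → Inc s u e × Inc s v e
  Joins⇒Inc (inj₁ (refl , refl)) = inj₁ here , inj₂ here
  Joins⇒Inc (inj₂ (refl , refl)) = inj₂ here , inj₁ here

  Same-contract-src : ∀ {s u e} → Inc s u e → Same (upd s e contr) u (src e)
  Same-contract-src (inj₁ u~src) = Same-mono (⊑-upd-contr _ _) u~src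
  Same-contract-src {s} {e = e} (inj₂ u~tgt) =
    Same-trans (Same-mono (⊑-upd-contr s e) u~tgt) (via e (upd-≡ s e contr) (inj₂ (refl , refl)) here)

  Same-contract⁺ : ∀ {s e a b} → Same s a b ⊎ (Inc s a e × Inc s b e) → Same (upd s e contr) a b
  Same-contract⁺ (inj₁ a~b)         = Same-mono (⊑-upd-contr _ _) a~b
  Same-contract⁺ (inj₂ (a-e , b-e)) = Same-trans (Same-contract-src a-e) (Same-sym (Same-contract-src b-e))

  Same-contract⁻ : ∀ {s e a b} → Same (upd s e contr) a b → Same s a b ⊎ (Inc s a e × Inc s b e)
  Same-contract⁻ here = inj₁ here
  Same-contract⁻ {s} {e} (via g c j p) with g ≟ e | Same-contract⁻ p
  ... | no _     | inj₁ v~b         = inj₁ (via g c j v~b)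
  ... | no _     | inj₂ (v-e , b-e) = inj₂ (Inc-Same (via g c j here) v-e , b-e)
  ... | yes refl | inj₁ v~b         = inj₂ (proj₁ (Joins⇒Inc j) , Inc-Same (Same-sym v~b) (proj₂ (Joins⇒Inc j)))
  ... | yes refl | inj₂ (_ , b-e)   = inj₂ (proj₁ (Joins⇒Inc j) , b-e)

  Inc-contract : ∀ {s e u g} → Inc s u g → Inc (upd s e contr) u g
  Inc-contract {s} {e} = Inc-mono (⊑-upd-contr s e)

  Same-contract-both : ∀ {s e a b} → Inc s a e → Inc s b e → Same (upd s e contr) a b
  Same-contract-both a-e b-e = Same-contract⁺ (inj₂ (a-e , b-e))

  Same-contract-away : ∀ {s e a b} → ¬ Inc s a e → Same (upd s e contr) a b → Same s a b
  Same-contract-away a∤e a~b with Same-contract⁻ a~b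
  ... | inj₁ a~b′      = a~b′
  ... | inj₂ (a-e , _) = contradiction a-e a∤e

  Inc-contract-away : ∀ {s e a g} → ¬ Inc s a e → Inc (upd s e contr) a g → Inc s a g
  Inc-contract-away a∤e = Sum.map (Same-contract-away a∤e) (Same-contract-away a∤e)

  Contr? : ∀ x → Dec (x ≡ contr)
  Contr? live  = no λ ()
  Contr? dead  = no λ ()
  Contr? contr = yes refl

  Live? : ∀ s e → Dec (Live s e)
  Live? s e with s e
  ... | live  = yes refl
  ... | dead  = no λ ()
  ... | contr = no λ ()

  SameDecidable : State → Set
  SameDecidable s = ∀ u v → Dec (Same s u v)

  Same?-resp : ∀ {s t} → s ⊑ t → t ⊑ s → SameDecidable s → SameDecidable t
  Same?-resp s⊑t t⊑s Same? u v = map′ (Same-mono s⊑t) (Same-mono t⊑s) (Same? u v)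

  Same?-contract : ∀ {s} e → SameDecidable s → SameDecidable (upd s e contr)
  Same?-contract {s} e Same? a b =
    map′ Same-contract⁺ Same-contract⁻ (Same? a b ⊎-dec (Inc?′ a ×-dec Inc?′ b))
    where
    Inc?′ : ∀ u → Dec (Inc s u e)
    Inc?′ u = Same? u (src e) ⊎-dec Same? u (tgt e)

  -- Same s is decided by restoring the contracted edges of s one at a time.
  Same?-undelete : ∀ {s} e → SameDecidable (upd s e dead) → SameDecidable s
  Same?-undelete {s} e Same? with Contr? (s e)
  ... | yes s-e = Same?-resp (≋⇒⊑ restored) (≋⇒⊑ (≋-sym restored)) (Same?-contract e Same?)
    where
    restored : upd (upd s e dead) e contr ≋ s
    restored g with g ≟ e
    ... | yes refl = sym s-e
    ... | no  _    = refl
  ... | no s-e = Same?-resp (upd-dead-⊑ s e) (⊑-upd-dead s-e) Same?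

  Same?-within : ∀ es s → (∀ e → s e ≡ contr → e ∈ˡ es) → SameDecidable s
  Same?-within []       s contr⊆[] u v = map′ (λ { refl → here }) only-here (u ≟ v)
    where
    only-here : Same s u v → u ≡ v
    only-here here = refl
    only-here (via e c _ _) with contr⊆[] e c
    ... | ()
  Same?-within (e ∷ es) s contr⊆e∷es = Same?-undelete e (Same?-within es (upd s e dead) contr⊆es)
    where
    contr⊆es : ∀ g → upd s e dead g ≡ contr → g ∈ˡ es
    contr⊆es g c with g ≟ e
    ... | no g≢e with contr⊆e∷es g c
    ...   | here g≡e  = contradiction g≡e g≢e
    ...   | there g∈es = g∈es

  Same? : ∀ s → SameDecidable s
  Same? s = Same?-within (allFin nE) s (λ e _ → ∈-allFin e)

  Inc? : ∀ s u e → Dec (Inc s u e)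
  Inc? s u e = Same? s u (src e) ⊎-dec Same? s u (tgt e)

  vertices : ∀ {s u v} → Same s u v → List (Fin nV)
  vertices {u = u} here          = u ∷ []
  vertices {u = u} (via _ _ _ p) = u ∷ vertices p

  edgesOf : ∀ {s u v} → Same s u v → List (Fin nE)
  edgesOf here          = []
  edgesOf (via e _ _ p) = e ∷ edgesOf p

  SimplePath : State → Fin nV → Fin nV → Set
  SimplePath s u v = Σ (Same s u v) (Unique ∘ vertices)

  start∈vertices : ∀ {s u v} (p : Same s u v) → u ∈ˡ vertices p
  start∈vertices here          = here refl
  start∈vertices (via _ _ _ _) = here refl

  suffix : ∀ {s u v w} (p : Same s v w) → u ∈ˡ vertices p → Unique (vertices p) → SimplePath s u w
  suffix here          (here refl) simple         = here , simple
  suffix (via e c j p) (here refl) simple         = via e c j p , simple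
  suffix (via e c j p) (there u∈p) (_ ∷ simple-p) = suffix p u∈p simple-p

  simplify : ∀ {s u w} → Same s u w → SimplePath s u w
  simplify here = here , [] ∷ []
  simplify {u = u} (via e c j p) with simplify p
  ... | q , simple-q with u ∈ˡ? vertices q
  ...   | no  u∉q = via e c j q , ¬Any⇒All¬ _ u∉q ∷ simple-q
  ...   | yes u∈q = suffix q u∈q simple-q

  edgesOf-contracted : ∀ {s u w g} (p : Same s u w) → g ∈ˡ edgesOf p → s g ≡ contr
  edgesOf-contracted (via e c j p) (here refl) = c
  edgesOf-contracted (via e c j p) (there g∈p) = edgesOf-contracted p g∈p

  ends∈vertices : ∀ {s u w g} (p : Same s u w) → g ∈ˡ edgesOf p →
                  src g ∈ˡ vertices p × tgt g ∈ˡ vertices p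
  ends∈vertices (via e c (inj₁ (refl , refl)) p) (here refl) = here refl , there (start∈vertices p)
  ends∈vertices (via e c (inj₂ (refl , refl)) p) (here refl) = there (start∈vertices p) , here refl
  ends∈vertices (via e c j p) (there g∈p) = Product.map there there (ends∈vertices p g∈p)

  simple⇒edges-unique : ∀ {s u w} (p : Same s u w) → Unique (vertices p) → Unique (edgesOf p)
  simple⇒edges-unique here _ = []
  simple⇒edges-unique (via e c j p) (u∉p ∷ simple-p) =
    ¬Any⇒All¬ _ (λ e∈p → All¬⇒¬Any u∉p (start-on-p j (ends∈vertices p e∈p)))
    ∷ simple⇒edges-unique p simple-p
    where
    start-on-p : ∀ {u v} → Joins e u v → src e ∈ˡ vertices p × tgt e ∈ˡ vertices p → u ∈ˡ vertices p
    start-on-p (inj₁ (refl , _)) = proj₁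
    start-on-p (inj₂ (_ , refl)) = proj₂

  Inc-orientation : ∀ {s a b e} → Inc s a e → Inc s b e → ¬ Same s a b →
                    (Same s a (src e) × Same s b (tgt e)) ⊎ (Same s a (tgt e) × Same s b (src e))
  Inc-orientation (inj₁ a~src) (inj₁ b~src) a≁b = contradiction (Same-trans a~src (Same-sym b~src)) a≁b
  Inc-orientation (inj₁ a~src) (inj₂ b~tgt) a≁b = inj₁ (a~src , b~tgt)
  Inc-orientation (inj₂ a~tgt) (inj₁ b~src) a≁b = inj₂ (a~tgt , b~src)
  Inc-orientation (inj₂ a~tgt) (inj₂ b~tgt) a≁b = contradiction (Same-trans a~tgt (Same-sym b~tgt)) a≁b

  Inc-two-classes : ∀ {s a b e y} → Inc s a e → Inc s b e → ¬ Same s a b →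
                    Inc s y e → Same s y a ⊎ Same s y b
  Inc-two-classes a-e b-e a≁b y-e with Inc-orientation a-e b-e a≁b | y-e
  ... | inj₁ (a~src , b~tgt) | inj₁ y~src = inj₁ (Same-trans y~src (Same-sym a~src))
  ... | inj₁ (a~src , b~tgt) | inj₂ y~tgt = inj₂ (Same-trans y~tgt (Same-sym b~tgt))
  ... | inj₂ (a~tgt , b~src) | inj₁ y~src = inj₂ (Same-trans y~src (Same-sym b~src))
  ... | inj₂ (a~tgt , b~src) | inj₂ y~tgt = inj₁ (Same-trans y~tgt (Same-sym a~tgt))

  Same-contract-between : ∀ {s g u v y} → Inc s u g → Inc s v g → ¬ Same s u v →
                          Same (upd s g contr) u y → Same s u y ⊎ Same s v y
  Same-contract-between u-g v-g u≁v u~y with Same-contract⁻ u~y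
  ... | inj₁ u~y′      = inj₁ u~y′
  ... | inj₂ (_ , y-g) = Sum.map Same-sym Same-sym (Inc-two-classes u-g v-g u≁v y-g)

  Inc-contract-between : ∀ {s g u v h} → Inc s u g → Inc s v g → ¬ Same s u v →
                         Inc (upd s g contr) u h → Inc s u h ⊎ Inc s v h
  Inc-contract-between u-g v-g u≁v (inj₁ u~src) = Sum.map inj₁ inj₁ (Same-contract-between u-g v-g u≁v u~src)
  Inc-contract-between u-g v-g u≁v (inj₂ u~tgt) = Sum.map inj₂ inj₂ (Same-contract-between u-g v-g u≁v u~tgt)

  IsRep : State → Fin nV → Set
  IsRep s v = ¬ (∃[ w ] w Fin.< v × Same s v w)

  IsRep? : ∀ s v → Dec (IsRep s v)
  IsRep? s v = ¬? (Finₚ.any? λ w → (w Fin.<? v) ×-dec Same? s v w)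

  rep : ∀ s v → ∃[ r ] Same s v r × IsRep s r
  rep s v = go v (<-wellFounded v)
    where
    go : ∀ v → Acc Fin._<_ v → ∃[ r ] Same s v r × IsRep s r
    go v (acc below) with Finₚ.any? (λ w → (w Fin.<? v) ×-dec Same? s v w)
    ... | no  none              = v , here , none
    ... | yes (w , w<v , v~w) with go w (below w<v)
    ...   | r , w~r , r-rep = r , Same-trans v~w w~r , r-rep

  rep-≤ : ∀ {s r w} → IsRep s r → Same s r w → r Fin.≤ w
  rep-≤ r-rep r~w = ℕₚ.≮⇒≥ (λ w<r → r-rep (_ , w<r , r~w))

  rep-unique : ∀ {s r r′} → IsRep s r → IsRep s r′ → Same s r r′ → r ≡ r′
  rep-unique r-rep r′-rep r~r′ = Finₚ.≤-antisym (rep-≤ r-rep r~r′) (rep-≤ r′-rep (Same-sym r~r′))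

  classes : State → ℕ
  classes s = count (IsRep? s)

  classes-merge : ∀ {s e r₁ r₂} → IsRep s r₁ → IsRep s r₂ → r₁ Fin.< r₂ → Inc s r₁ e → Inc s r₂ e →
                  classes s ≡ suc (classes (upd s e contr))
  classes-merge {s} {e} {r₁} {r₂} r₁-rep r₂-rep r₁<r₂ r₁-e r₂-e =
    count-add (IsRep? (upd s e contr)) (IsRep? s) r₂ (λ v v≢r₂ → rep-after , survives v≢r₂)
              r₂-absorbed r₂-rep
    where
    r₁≁r₂ : ¬ Same s r₁ r₂
    r₁≁r₂ r₁~r₂ = Finₚ.<⇒≢ r₁<r₂ (rep-unique r₁-rep r₂-rep r₁~r₂)

    class-of-end : ∀ {y} → Inc s y e → Same s y r₁ ⊎ Same s y r₂
    class-of-end = Inc-two-classes r₁-e r₂-e r₁≁r₂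

    r₂-absorbed : ¬ IsRep (upd s e contr) r₂
    r₂-absorbed r₂-rep′ = r₂-rep′ (r₁ , r₁<r₂ , Same-contract-both r₂-e r₁-e)

    rep-after : ∀ {v} → IsRep (upd s e contr) v → IsRep s v
    rep-after v-rep′ (w , w<v , v~w) = v-rep′ (w , w<v , Same-mono (⊑-upd-contr s e) v~w)

    survives : ∀ {v} → v ≢ r₂ → IsRep s v → IsRep (upd s e contr) v
    survives {v} v≢r₂ v-rep (w , w<v , v~w) with Same-contract⁻ v~w
    ... | inj₁ v~w′        = v-rep (w , w<v , v~w′)
    ... | inj₂ (v-e , w-e) = ℕₚ.<⇒≱ (subst (w Fin.<_) v≡r₁ w<v) r₁≤w
      where
      v≡r₁ : v ≡ r₁
      v≡r₁ with class-of-end v-e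
      ... | inj₁ v~r₁ = rep-unique v-rep r₁-rep v~r₁
      ... | inj₂ v~r₂ = contradiction (rep-unique v-rep r₂-rep v~r₂) v≢r₂
      r₁≤w : r₁ Fin.≤ w
      r₁≤w with class-of-end w-e
      ... | inj₁ w~r₁ = rep-≤ r₁-rep (Same-sym w~r₁)
      ... | inj₂ w~r₂ = ℕₚ.≤-trans (ℕₚ.<⇒≤ r₁<r₂) (rep-≤ r₂-rep (Same-sym w~r₂))

module Forest {nV nE : ℕ} (src tgt : Fin nE → Fin nV)
              (S : Subset nE) (S-acyclic : Graph.Acyclic src tgt S) where

  open Graph src tgt
  open Contraction src tgt
  open import Data.List.Relation.Unary.All using ([]; _∷_)
  open import Data.List.Relation.Unary.All.Properties using (¬Any⇒All¬)
  open import Data.List.Relation.Unary.AllPairs using ([]; _∷_)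
  open import Data.List.Relation.Unary.Unique.Propositional using (Unique)

  InForest : State → Set
  InForest s = ∀ e → s e ≢ dead → e ∈ S

  InForest-init : InForest (init S)
  InForest-init e not-dead with lookup S e in S-e
  ... | true  = lookup⇒[]= e S S-e
  ... | false = contradiction refl not-dead

  InForest-contract : ∀ {s e} → InForest s → Live s e → InForest (upd s e contr)
  InForest-contract {s} {e} forest live-e g not-dead with g ≟ e
  ... | yes refl = forest g (live⇒≢dead live-e)
  ... | no  _    = forest g not-dead

  InForest-delete : ∀ {s e} → InForest s → InForest (upd s e dead)
  InForest-delete {s} {e} forest g not-dead with g ≟ e
  ... | yes refl = contradiction refl not-dead
  ... | no  _    = forest g not-dead

  toWalk : ∀ {s u w} → InForest s → (p : Same s u w) → Σ (Walk S u w) (λ q → edges q ≡ edgesOf p)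
  toWalk forest here = [] , refl
  toWalk forest (via e c j p) with toWalk forest p
  ... | q , q≡p = (e , forest e (contr⇒≢dead c) , j) ∷ q , cong (e ∷_) q≡p

  live-ends-apart : ∀ {s e} → InForest s → Live s e → ¬ Same s (src e) (tgt e)
  live-ends-apart {s} {e} forest live-e src~tgt with simplify (Same-sym src~tgt)
  ... | p , simple-p with toWalk forest p
  ...   | q , q≡p = nonempty (S-acyclic (src e) cycle (subst (Unique ∘ (e ∷_)) (sym q≡p) trail))
    where
    cycle : Walk S (src e) (src e)
    cycle = (e , forest e (live⇒≢dead live-e) , inj₁ (refl , refl)) ∷ q
    trail : Unique (e ∷ edgesOf p)
    trail = ¬Any⇒All¬ _ (λ e∈p → live⇒≢contr live-e (edgesOf-contracted p e∈p))
            ∷ simple⇒edges-unique p simple-p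
    nonempty : e ∷ edges q ≢ []
    nonempty ()

  other-end : ∀ {s e u} → InForest s → Live s e → Inc s u e → ∃[ x ] Inc s x e × ¬ Same s u x
  other-end forest live-e (inj₁ u~src) =
    _ , inj₂ here , λ u~tgt → live-ends-apart forest live-e (Same-trans (Same-sym u~src) u~tgt)
  other-end forest live-e (inj₂ u~tgt) =
    _ , inj₁ here , λ u~src → live-ends-apart forest live-e (Same-trans (Same-sym u~src) u~tgt)

  no-parallel : ∀ {s e g a b} → InForest s → Live s e → Live s g → e ≢ g →
                Inc s a e → Inc s b e → Inc s a g → Inc s b g → ¬ Same s a b → ⊥
  no-parallel {s} {e} {g} {a} forest live-e live-g e≢g a-e b-e a-g b-g a≁b =
    live-ends-apart (InForest-contract forest live-g) (upd-Live⁺ s g e≢g live-e)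
      (Same-trans (to-a (inj₁ here)) (Same-sym (to-a (inj₂ here))))
    where
    to-a : ∀ {y} → Inc s y e → Same (upd s g contr) y a
    to-a y-e with Inc-two-classes a-e b-e a≁b y-e
    ... | inj₁ y~a = Same-mono (⊑-upd-contr s g) y~a
    ... | inj₂ y~b = Same-trans (Same-mono (⊑-upd-contr s g) y~b) (Same-sym (Same-contract-both a-g b-g))

  classes-contract : ∀ {s e} → InForest s → Live s e → classes s ≡ suc (classes (upd s e contr))
  classes-contract {s} {e} forest live-e with rep s (src e) | rep s (tgt e)
  ... | r₁ , src~r₁ , r₁-rep | r₂ , tgt~r₂ , r₂-rep with Finₚ.<-cmp r₁ r₂
  ...   | tri< r₁<r₂ _ _ = classes-merge r₁-rep r₂-rep r₁<r₂ (inj₁ (Same-sym src~r₁)) (inj₂ (Same-sym tgt~r₂))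
  ...   | tri≈ _ refl _  = contradiction (Same-trans src~r₁ (Same-sym tgt~r₂)) (live-ends-apart forest live-e)
  ...   | tri> _ _ r₂<r₁ = classes-merge r₂-rep r₁-rep r₂<r₁ (inj₂ (Same-sym tgt~r₂)) (inj₁ (Same-sym src~r₁))

module Reduction {nV nE : ℕ} (src tgt : Fin nE → Fin nV)
                 (S : Subset nE) (S-acyclic : Graph.Acyclic src tgt S)
                 (Term : Fin nV → Set) (Contract : Fin nE → Fin nE → Set)
                 (Contract-asym : Asymmetric Contract) (Contract-trans : Transitive Contract) where

  open Graph src tgt
  open Contraction src tgt
  open Forest src tgt S S-acyclic

  Terminal : State → Fin nV → Set
  Terminal = TermV Term

  _⟶_ : State → State → Set
  _⟶_ = Step Term Contract

  LeavesTerminal : State → Set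
  LeavesTerminal s = ∀ u e → Deg1 s u e → Terminal s u

  Joinable : State → State → Set
  Joinable s₁ s₂ = ∃₂ λ t₁ t₂ → s₁ ⟶ t₁ × s₂ ⟶ t₂ × t₁ ≋ t₂

  Deg2-live₁ : ∀ {s u e e′} → Deg2 s u e e′ → Live s e
  Deg2-live₁ (_ , live-e , _) = live-e

  Deg2-only : ∀ {s u e e′} → Deg2 s u e e′ → ∀ h → Live s h → Inc s u h → h ≡ e ⊎ h ≡ e′
  Deg2-only (_ , _ , _ , _ , _ , only) = only

  Joinable-sym : ∀ {s₁ s₂} → Joinable s₁ s₂ → Joinable s₂ s₁
  Joinable-sym (t₁ , t₂ , s₁⟶t₁ , s₂⟶t₂ , t₁≋t₂) = t₂ , t₁ , s₂⟶t₂ , s₁⟶t₁ , ≋-sym t₁≋t₂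

  Terminal-mono : ∀ {s t u} → s ⊑ t → Terminal s u → Terminal t u
  Terminal-mono s⊑t (y , u~y , term-y) = y , Same-mono s⊑t u~y , term-y

  Terminal-Same : ∀ {s u v} → Same s u v → Terminal s v → Terminal s u
  Terminal-Same u~v (y , v~y , term-y) = y , Same-trans u~v v~y , term-y

  Terminal-contract-away : ∀ {s e v} → ¬ Inc s v e → Terminal (upd s e contr) v → Terminal s v
  Terminal-contract-away v∤e (y , v~y , term-y) = y , Same-contract-away v∤e v~y , term-y

  Live-≋ : ∀ {s t e} → s ≋ t → Live s e → Live t e
  Live-≋ {e = e} s≋t = trans (sym (s≋t e))

  Deg1-≋ : ∀ {s t u e} → s ≋ t → Deg1 s u e → Deg1 t u e
  Deg1-≋ s≋t (live-e , u-e , only) =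
    Live-≋ s≋t live-e , Inc-mono (≋⇒⊑ s≋t) u-e ,
    λ g live-g u-g → only g (Live-≋ (≋-sym s≋t) live-g) (Inc-mono (≋⇒⊑ (≋-sym s≋t)) u-g)

  Deg2-≋ : ∀ {s t u e e′} → s ≋ t → Deg2 s u e e′ → Deg2 t u e e′
  Deg2-≋ s≋t (e≢e′ , live-e , live-e′ , u-e , u-e′ , only) =
    e≢e′ , Live-≋ s≋t live-e , Live-≋ s≋t live-e′ ,
    Inc-mono (≋⇒⊑ s≋t) u-e , Inc-mono (≋⇒⊑ s≋t) u-e′ ,
    λ g live-g u-g → only g (Live-≋ (≋-sym s≋t) live-g) (Inc-mono (≋⇒⊑ (≋-sym s≋t)) u-g)

  ⟶-resp-≋ : ∀ {s t s′} → s ≋ t → s ⟶ s′ → ∃[ t′ ] t ⟶ t′ × s′ ≋ t′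
  ⟶-resp-≋ s≋t (delete u e D nonterm) =
    _ , delete u e (Deg1-≋ s≋t D) (nonterm ∘ Terminal-mono (≋⇒⊑ (≋-sym s≋t))) , upd-≋ e dead s≋t
  ⟶-resp-≋ s≋t (contract u e e′ D nonterm c leaves) =
    _ , contract u e e′ (Deg2-≋ s≋t D) (nonterm ∘ Terminal-mono (≋⇒⊑ (≋-sym s≋t))) c
          (λ v g D′ → Terminal-mono (≋⇒⊑ s≋t) (leaves v g (Deg1-≋ (≋-sym s≋t) D′))) ,
    upd-≋ e contr s≋t

  InForest-⟶ : ∀ {s s′} → InForest s → s ⟶ s′ → InForest s′
  InForest-⟶ forest (delete _ _ _ _)                       = InForest-delete forest
  InForest-⟶ forest (contract _ _ _ (_ , live-e , _) _ _ _) = InForest-contract forest live-e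

  InForest-↠ : ∀ {s t} → InForest s → Star _⟶_ s t → InForest t
  InForest-↠ forest ε             = forest
  InForest-↠ forest (s⟶s′ ◅ s′↠t) = InForest-↠ (InForest-⟶ forest s⟶s′) s′↠t

  contract-LeavesTerminal : ∀ {s u e e′} → InForest s → Deg2 s u e e′ → LeavesTerminal s →
                            LeavesTerminal (upd s e contr)
  contract-LeavesTerminal {s} {u} {e} {e′} forest (e≢e′ , live-e , live-e′ , u-e , u-e′ , _) leaves a g
                          (live-g′ , a-g′ , only-a) with Inc? s a e
  ... | no a∤e = Terminal-mono (⊑-upd-contr s e) (leaves a g (live-g , Inc-contract-away a∤e a-g′ , only-a-before))
    where
    live-g : Live s g
    live-g = proj₂ (upd-Live⁻ s e (λ ()) live-g′)
    only-a-before : ∀ h → Live s h → Inc s a h → h ≡ g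
    only-a-before h live-h a-h = only-a h (upd-Live⁺ s e (λ { refl → a∤e a-h }) live-h) (Inc-contract a-h)
  -- The merged class keeps e′ as its only edge, so e is the only edge at its far end x:
  -- any other one would be e′, parallel to e.
  ... | yes a-e with other-end forest live-e u-e
  ...   | x , x-e , u≁x =
    Terminal-Same (Same-contract-both a-e x-e) (Terminal-mono (⊑-upd-contr s e) (leaves x e (live-e , x-e , only-x)))
    where
    e′≡g : e′ ≡ g
    e′≡g = only-a e′ (upd-Live⁺ s e (e≢e′ ∘ sym) live-e′)
                     (Inc-Same (Same-contract-both a-e u-e) (Inc-contract u-e′))
    only-x : ∀ h → Live s h → Inc s x h → h ≡ e
    only-x h live-h x-h with h ≟ e
    ... | yes h≡e = h≡e
    ... | no  h≢e = ⊥-elim (no-parallel forest live-e live-e′ e≢e′ u-e x-e u-e′ x-e′ u≁x)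
      where
      h≡g : h ≡ g
      h≡g = only-a h (upd-Live⁺ s e h≢e live-h) (Inc-Same (Same-contract-both a-e x-e) (Inc-contract x-h))
      x-e′ : Inc s x e′
      x-e′ = subst (Inc s x) (trans h≡g (sym e′≡g)) x-h

  Deg2-contract-away : ∀ {s e v f f′} → ¬ Inc s v e → Deg2 s v f f′ → Deg2 (upd s e contr) v f f′
  Deg2-contract-away {s} {e} v∤e (f≢f′ , live-f , live-f′ , v-f , v-f′ , only) =
    f≢f′ ,
    upd-Live⁺ s e (λ { refl → v∤e v-f }) live-f , upd-Live⁺ s e (λ { refl → v∤e v-f′ }) live-f′ ,
    Inc-contract v-f , Inc-contract v-f′ ,
    λ h live-h v-h → only h (proj₂ (upd-Live⁻ s e (λ ()) live-h)) (Inc-contract-away v∤e v-h)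

  delete-survives : ∀ {s e v f} → Live s e → f ≢ e → Deg1 s v f → ¬ Terminal s v →
                    upd s e dead ⟶ upd (upd s e dead) f dead
  delete-survives {s} {e} {v} {f} live-e f≢e (live-f , v-f , only) nonterm =
    delete v f (upd-Live⁺ s e f≢e live-f , Inc-mono s⊑s′ v-f ,
                λ h live-h v-h → only h (proj₂ (upd-Live⁻ s e (λ ()) live-h)) (Inc-mono (upd-dead-⊑ s e) v-h))
               (nonterm ∘ Terminal-mono (upd-dead-⊑ s e))
    where
    s⊑s′ : s ⊑ upd s e dead
    s⊑s′ = ⊑-upd-dead (live⇒≢contr live-e)

  contract-survives : ∀ {s u e e′ v f f′} → InForest s → Deg2 s u e e′ → LeavesTerminal s →
                      Deg2 s v f f′ → ¬ Terminal s v → Contract f f′ → ¬ Inc s v e →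
                      upd s e contr ⟶ upd (upd s e contr) f contr
  contract-survives {v = v} {f} {f′} forest D leaves D′ nonterm c v∤e =
    contract v f f′ (Deg2-contract-away v∤e D′) (nonterm ∘ Terminal-contract-away v∤e) c
             (contract-LeavesTerminal forest D leaves)

  adjacent-contractions-join :
    ∀ {s u e e′ v f′} → InForest s →
    Deg2 s u e e′ → ¬ Terminal s u → Contract e e′ → LeavesTerminal s →
    Deg2 s v e′ f′ → ¬ Terminal s v → Contract e′ f′ → ¬ Inc s v e →
    Joinable (upd s e contr) (upd s e′ contr)
  adjacent-contractions-join {s} {u} {e} {e′} {v} {f′} forest
    D@(e≢e′ , live-e , _ , u-e , u-e′ , only-u) nonterm-u c leaves
    D′@(e′≢f′ , _ , live-f′ , v-e′ , v-f′ , only-v) nonterm-v c′ v∤e =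
    _ , _ , contract-survives forest D leaves D′ nonterm-v c′ v∤e ,
    contract u e f′ D″ nonterm″ (Contract-trans c c′) (contract-LeavesTerminal forest D′ leaves) ,
    upd-comm s contr contr e≢e′
    where
    u≁v : ¬ Same s u v
    u≁v u~v = v∤e (Inc-Same (Same-sym u~v) u-e)

    D″ : Deg2 (upd s e′ contr) u e f′
    D″ = (λ { refl → v∤e v-f′ }) ,
         upd-Live⁺ s e′ e≢e′ live-e , upd-Live⁺ s e′ (e′≢f′ ∘ sym) live-f′ ,
         Inc-contract u-e , Inc-Same (Same-contract-both u-e′ v-e′) (Inc-contract v-f′) , only″
      where
      only″ : ∀ h → Live (upd s e′ contr) h → Inc (upd s e′ contr) u h → h ≡ e ⊎ h ≡ f′
      only″ h live-h u-h with upd-Live⁻ s e′ (λ ()) live-h | Inc-contract-between u-e′ v-e′ u≁v u-h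
      ... | h≢e′ , live-h′ | inj₁ u-h′ = Sum.map₂ (flip contradiction h≢e′) (only-u h live-h′ u-h′)
      ... | h≢e′ , live-h′ | inj₂ v-h′ = Sum.map₁ (flip contradiction h≢e′) (only-v h live-h′ v-h′)

    nonterm″ : ¬ Terminal (upd s e′ contr) u
    nonterm″ (y , u~y , term-y) with Same-contract-between u-e′ v-e′ u≁v u~y
    ... | inj₁ u~y′ = nonterm-u (y , u~y′ , term-y)
    ... | inj₂ v~y  = nonterm-v (y , v~y , term-y)

  diamond : ∀ {s s₁ s₂} → InForest s → s ⟶ s₁ → s ⟶ s₂ → s₁ ≋ s₂ ⊎ Joinable s₁ s₂
  diamond {s} forest (delete u e D nonterm) (delete v f D′ nonterm′) with e ≟ f
  ... | yes refl = inj₁ (λ _ → refl)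
  ... | no  e≢f  = inj₂ (_ , _ , delete-survives (proj₁ D) (e≢f ∘ sym) D′ nonterm′ ,
                                 delete-survives (proj₁ D′) e≢f D nonterm , upd-comm s dead dead e≢f)
  diamond forest (delete u e D nonterm) (contract _ _ _ _ _ _ leaves) = ⊥-elim (nonterm (leaves u e D))
  diamond forest (contract _ _ _ _ _ _ leaves) (delete v f D nonterm) = ⊥-elim (nonterm (leaves v f D))
  diamond {s} forest (contract u e e′ D nonterm c leaves) (contract v f f′ D′ nonterm′ c′ leaves′) with e ≟ f
  ... | yes refl = inj₁ (λ _ → refl)
  ... | no  e≢f with Inc? s v e | Inc? s u f
  ...   | no v∤e | no u∤f =
    inj₂ (_ , _ , contract-survives forest D leaves D′ nonterm′ c′ v∤e ,
                  contract-survives forest D′ leaves′ D nonterm c u∤f , upd-comm s contr contr e≢f)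
  ...   | no v∤e | yes u-f with Deg2-only D f (Deg2-live₁ D′) u-f
  ...     | inj₁ refl = contradiction refl e≢f
  ...     | inj₂ refl = inj₂ (adjacent-contractions-join forest D nonterm c leaves D′ nonterm′ c′ v∤e)
  diamond {s} forest (contract u e e′ D nonterm c leaves) (contract v f f′ D′ nonterm′ c′ leaves′)
    | no e≢f | yes v-e | no u∤f with Deg2-only D′ e (Deg2-live₁ D) v-e
  ...     | inj₁ refl = contradiction refl e≢f
  ...     | inj₂ refl =
    inj₂ (Joinable-sym (adjacent-contractions-join forest D′ nonterm′ c′ leaves′ D nonterm c u∤f))
  diamond {s} forest (contract u e e′ D nonterm c leaves) (contract v f f′ D′ nonterm′ c′ leaves′)
    | no e≢f | yes v-e | yes u-f with Deg2-only D f (Deg2-live₁ D′) u-f | Deg2-only D′ e (Deg2-live₁ D) v-e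
  ...     | inj₁ refl | _         = contradiction refl e≢f
  ...     | inj₂ _    | inj₁ refl = contradiction refl e≢f
  -- here f = e′ and e = f′: each of e and f is contracted in preference to the other
  ...     | inj₂ refl | inj₂ refl = ⊥-elim (Contract-asym c c′)

  open UniqueNormalForm _≋_ ≋-isEquivalence _⟶_ InForest InForest-⟶ ⟶-resp-≋ diamond using (normalForm-unique)

  SameResult-≋ : ∀ {s s′} → s ≋ s′ → SameResult s s′
  SameResult-≋ s≋s′ = (λ e → Live-≋ s≋s′ , Live-≋ (≋-sym s≋s′)) ,
                      (λ e f _ _ b c → Same-mono (≋⇒⊑ s≋s′) , Same-mono (≋⇒⊑ (≋-sym s≋s′)))

  reduction-unique : ∀ {s s′} → Reduces Term Contract S s → Reduces Term Contract S s′ → SameResult s s′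
  reduction-unique (init↠s , s-final) (init↠s′ , s′-final) =
    SameResult-≋ (normalForm-unique InForest-init init↠s (λ (t , s⟶t) → s-final t s⟶t)
                                                  init↠s′ (λ (t , s′⟶t) → s′-final t s′⟶t))

module Size {nV nE : ℕ} (src tgt : Fin nE → Fin nV)
            (S : Subset nE) (S-acyclic : Graph.Acyclic src tgt S) (X : Subset nE)
            (Contract : Fin nE → Fin nE → Set)
            (Contract-asym : Asymmetric Contract) (Contract-trans : Transitive Contract)
            (Contract-total : ∀ {e e′} → e ≢ e′ → Contract e e′ ⊎ Contract e′ e) where

  open Graph src tgt
  open Contraction src tgt
  open Forest src tgt S S-acyclic
  open Counting
  open import Algebra.Properties.Semiring.Sum ℕₚ.+-*-semiring
    using (sum; ∑-distrib-+; ∑-comm; *-distribˡ-sum)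

  EndOfX : Fin nV → Set
  EndOfX v = ∃[ e ] (e ∈ X × (src e ≡ v ⊎ tgt e ≡ v))

  open Reduction src tgt S S-acyclic EndOfX Contract Contract-asym Contract-trans

  Final : State → Set
  Final s = ∀ s′ → ¬ s ⟶ s′

  Terminal? : ∀ s v → Dec (Terminal s v)
  Terminal? s v = Finₚ.any? λ y → Same? s v y ×-dec EndOfX? y
    where
    EndOfX? : ∀ y → Dec (EndOfX y)
    EndOfX? y = Finₚ.any? λ e → (e ∈? X) ×-dec ((src e ≟ y) ⊎-dec (tgt e ≟ y))

  leaf-terminal : ∀ {s u e} → Final s → Deg1 s u e → Terminal s u
  leaf-terminal {s} {u} {e} final D with Terminal? s u
  ... | yes term    = term
  ... | no  nonterm = ⊥-elim (final _ (delete u e D nonterm))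

  Deg2-swap : ∀ {s u e e′} → Deg2 s u e e′ → Deg2 s u e′ e
  Deg2-swap (e≢e′ , live-e , live-e′ , u-e , u-e′ , only) =
    e≢e′ ∘ sym , live-e′ , live-e , u-e′ , u-e , λ h live-h u-h → Sum.swap (only h live-h u-h)

  deg2-terminal : ∀ {s u e e′} → Final s → Deg2 s u e e′ → Terminal s u
  deg2-terminal {s} {u} {e} {e′} final D with Terminal? s u
  ... | yes term    = term
  ... | no  nonterm with Contract-total (proj₁ D)
  ...   | inj₁ c = ⊥-elim (final _ (contract u e e′ D nonterm c (λ _ _ → leaf-terminal final)))
  ...   | inj₂ c = ⊥-elim (final _ (contract u e′ e (Deg2-swap D) nonterm c (λ _ _ → leaf-terminal final)))

  LiveInc? : ∀ s v g → Dec (Live s g × Inc s v g)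
  LiveInc? s v g = Live? s g ×-dec Inc? s v g

  degree : State → Fin nV → ℕ
  degree s v = count (LiveInc? s v)

  Isolated : State → Fin nV → Set
  Isolated s v = degree s v ≡ 0

  Isolated? : ∀ s v → Dec (Isolated s v)
  Isolated? s v = degree s v ℕ.≟ 0

  IsolatedRep? : ∀ s v → Dec (IsRep s v × Isolated s v)
  IsolatedRep? s v = IsRep? s v ×-dec Isolated? s v

  NonIsolatedRep? : ∀ s v → Dec (IsRep s v × ¬ Isolated s v)
  NonIsolatedRep? s v = IsRep? s v ×-dec ¬? (Isolated? s v)

  TerminalRep? : ∀ s v → Dec (IsRep s v × Terminal s v)
  TerminalRep? s v = IsRep? s v ×-dec Terminal? s v

  terminal-weight : ∀ {s v d} → 1 ≤ d → Terminal s v → 3 ≤ d + 2 * 𝟙 (Terminal? s v)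
  terminal-weight {s} {v} 1≤d term rewrite 𝟙-yes (Terminal? s v) term = ℕₚ.+-monoˡ-≤ 2 1≤d

  nonisolated⇒3≤degree+terminal : ∀ {s v} → Final s → ¬ Isolated s v →
                                  3 ≤ degree s v + 2 * 𝟙 (Terminal? s v)
  nonisolated⇒3≤degree+terminal {s} {v} final nonisolated with degree s v in degree≡
  ... | 0 = contradiction refl nonisolated
  ... | 1 with count≡1⇒ (LiveInc? s v) degree≡
  ...   | g , (live-g , v-g) , only =
    terminal-weight {d = 1} (s≤s z≤n) (leaf-terminal final (live-g , v-g , λ h live-h v-h → only h (live-h , v-h)))
  nonisolated⇒3≤degree+terminal {s} {v} final nonisolated | 2 with count≡2⇒ (LiveInc? s v) degree≡
  ...   | g , h , g≢h , (live-g , v-g) , (live-h , v-h) , only =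
    terminal-weight {d = 2} (s≤s z≤n)
      (deg2-terminal final (g≢h , live-g , live-h , v-g , v-h , λ i live-i v-i → only i (live-i , v-i)))
  nonisolated⇒3≤degree+terminal final nonisolated | suc (suc (suc d)) = s≤s (s≤s (s≤s z≤n))

  isolated-no-edge : ∀ {s v g} → Isolated s v → Live s g → ¬ Inc s v g
  isolated-no-edge {s} {v} {g} isolated live-g v-g =
    count≡0⇒¬ (LiveInc? s v) isolated g (live-g , v-g)

  liveCount : State → ℕ
  liveCount s = count (Live? s)

  isolatedReps : State → ℕ
  isolatedReps s = count (IsolatedRep? s)

  liveCount-contract : ∀ {s e} → Live s e → liveCount s ≡ suc (liveCount (upd s e contr))
  liveCount-contract {s} {e} live-e =
    count-add (Live? (upd s e contr)) (Live? s) e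
      (λ g g≢e → proj₂ ∘ upd-Live⁻ s e (λ ()) , upd-Live⁺ s e g≢e)
      (λ live-e′ → live⇒≢contr live-e′ (upd-≡ s e contr)) live-e

  isolatedRep-contract : ∀ {s e v} → Live s e → IsRep s v × Isolated s v →
                         IsRep (upd s e contr) v × Isolated (upd s e contr) v
  isolatedRep-contract {s} {e} {v} live-e (v-rep , isolated) =
    (λ (w , w<v , v~w) → v-rep (w , w<v , Same-contract-away v∤e v~w)) ,
    count-empty (LiveInc? (upd s e contr) v)
      (λ g (live-g , v-g) →
         isolated-no-edge isolated (proj₂ (upd-Live⁻ s e (λ ()) live-g)) (Inc-contract-away v∤e v-g))
    where
    v∤e : ¬ Inc s v e
    v∤e = isolated-no-edge isolated live-e

  -- Euler's formula for forests: contracting a live edge merges exactly two classes.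
  isolatedReps+live≤classes : ∀ k {s} → InForest s → liveCount s ≡ k → isolatedReps s + k ≤ classes s
  isolatedReps+live≤classes zero {s} _ _ =
    ℕₚ.≤-trans (ℕₚ.≤-reflexive (ℕₚ.+-identityʳ (isolatedReps s)))
               (count-mono (IsolatedRep? s) (IsRep? s) (λ _ → proj₁))
  isolatedReps+live≤classes (suc k) {s} forest live≡ with count-witness (Live? s) live≡
  ... | e , live-e = begin
    isolatedReps s + suc k
      ≡⟨ ℕₚ.+-suc _ k ⟩
    suc (isolatedReps s + k)
      ≤⟨ s≤s (ℕₚ.+-monoˡ-≤ k (count-mono (IsolatedRep? s) (IsolatedRep? s₁) (λ _ → isolatedRep-contract live-e))) ⟩
    suc (isolatedReps s₁ + k)
      ≤⟨ s≤s (isolatedReps+live≤classes k (InForest-contract forest live-e) live₁≡) ⟩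
    suc (classes s₁)
      ≡⟨ classes-contract forest live-e ⟨
    classes s ∎
    where
    open ℕₚ.≤-Reasoning
    s₁ : State
    s₁ = upd s e contr
    live₁≡ : liveCount s₁ ≡ k
    live₁≡ = ℕₚ.suc-injective (trans (sym (liveCount-contract live-e)) live≡)

  live≤nonisolatedReps : ∀ {s} → InForest s → liveCount s ≤ count (NonIsolatedRep? s)
  live≤nonisolatedReps {s} forest =
    ℕₚ.+-cancelˡ-≤ (isolatedReps s) _ _
      (ℕₚ.≤-trans (isolatedReps+live≤classes _ forest refl)
                  (ℕₚ.≤-reflexive (count-split (IsRep? s) (Isolated? s))))

  reps-in-class≤1 : ∀ s y → count (λ v → IsRep? s v ×-dec Same? s v y) ≤ 1
  reps-in-class≤1 s y = count≤1 (λ v → IsRep? s v ×-dec Same? s v y)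
    λ i j (i-rep , i~y) (j-rep , j~y) → rep-unique i-rep j-rep (Same-trans i~y (Same-sym j~y))

  reps-incident≤2 : ∀ s g → count (λ v → IsRep? s v ×-dec Inc? s v g) ≤ 2
  reps-incident≤2 s g =
    ℕₚ.≤-trans (count-mono (λ v → IsRep? s v ×-dec Inc? s v g) (λ v → rep-at (src g) v ⊎-dec rep-at (tgt g) v)
                           (λ v (v-rep , v-g) → Sum.map (v-rep ,_) (v-rep ,_) v-g))
    (ℕₚ.≤-trans (count-∪ (rep-at (src g)) (rep-at (tgt g)))
                (ℕₚ.+-mono-≤ (reps-in-class≤1 s (src g)) (reps-in-class≤1 s (tgt g))))
    where
    rep-at : ∀ y v → Dec (IsRep s v × Same s v y)
    rep-at y v = IsRep? s v ×-dec Same? s v y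

  incidences : ∀ {A : Fin nE → Set} → State → (∀ g → Dec (A g)) → ℕ
  incidences s A? = sum λ v → count λ g → IsRep? s v ×-dec (A? g ×-dec Inc? s v g)

  incidences≤ : ∀ {A : Fin nE → Set} s (A? : ∀ g → Dec (A g)) → incidences s A? ≤ 2 * count A?
  incidences≤ s A? = begin
    incidences s A?
      ≡⟨ ∑-comm (λ v g → 𝟙 (IsRep? s v ×-dec (A? g ×-dec Inc? s v g))) ⟩
    sum (λ g → count (λ v → IsRep? s v ×-dec (A? g ×-dec Inc? s v g)))
      ≤⟨ sum-mono-≤ per-edge ⟩
    sum (λ g → 2 * 𝟙 (A? g))
      ≡⟨ *-distribˡ-sum 2 (λ g → 𝟙 (A? g)) ⟨
    2 * count A? ∎
    where
    open ℕₚ.≤-Reasoning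
    per-edge : ∀ g → count (λ v → IsRep? s v ×-dec (A? g ×-dec Inc? s v g)) ≤ 2 * 𝟙 (A? g)
    per-edge g = count-guarded (λ v → IsRep? s v ×-dec (A? g ×-dec Inc? s v g)) (A? g) (λ _ (_ , a , _) → a)
      (λ _ → ℕₚ.≤-trans (count-mono (λ v → IsRep? s v ×-dec (A? g ×-dec Inc? s v g)) (λ v → IsRep? s v ×-dec Inc? s v g)
                                    (λ _ (v-rep , _ , v-g) → v-rep , v-g))
                        (reps-incident≤2 s g))

  nonisolatedReps-bound :
    ∀ {s} → Final s →
    3 * count (NonIsolatedRep? s)
      ≤ incidences s (Live? s) + 2 * count (TerminalRep? s)
  nonisolatedReps-bound {s} final = begin
    3 * count (NonIsolatedRep? s)
      ≡⟨ *-distribˡ-sum 3 (λ v → 𝟙 (NonIsolatedRep? s v)) ⟩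
    sum (λ v → 3 * 𝟙 (NonIsolatedRep? s v))
      ≤⟨ sum-mono-≤ pointwise ⟩
    sum (λ v → count (λ g → IsRep? s v ×-dec (Live? s g ×-dec Inc? s v g)) + 2 * 𝟙 (TerminalRep? s v))
      ≡⟨ ∑-distrib-+ (λ v → count (λ g → IsRep? s v ×-dec (Live? s g ×-dec Inc? s v g)))
                     (λ v → 2 * 𝟙 (TerminalRep? s v)) ⟩
    incidences s (Live? s) + sum (λ v → 2 * 𝟙 (TerminalRep? s v))
      ≡⟨ cong (incidences s (Live? s) +_) (*-distribˡ-sum 2 (λ v → 𝟙 (TerminalRep? s v))) ⟨
    incidences s (Live? s) + 2 * count (TerminalRep? s) ∎
    where
    open ℕₚ.≤-Reasoning
    pointwise : ∀ v → 3 * 𝟙 (NonIsolatedRep? s v)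
                      ≤ count (λ g → IsRep? s v ×-dec LiveInc? s v g) + 2 * 𝟙 (TerminalRep? s v)
    pointwise v = weight (IsRep? s v) (Isolated? s v)
      where
      weight : ∀ {R} (r : Dec R) (i : Dec (Isolated s v)) →
               3 * 𝟙 (r ×-dec ¬? i) ≤ count (λ g → r ×-dec LiveInc? s v g) + 2 * 𝟙 (r ×-dec Terminal? s v)
      weight (no _)  _                = z≤n
      weight (yes _) (yes _)          = z≤n
      weight (yes _) (no nonisolated) = nonisolated⇒3≤degree+terminal final nonisolated

  terminalReps≤incidences : ∀ s → count (TerminalRep? s) ≤ incidences s (_∈? X)
  terminalReps≤incidences s = sum-mono-≤ λ v →
    𝟙≤count (TerminalRep? s v) (λ e → IsRep? s v ×-dec ((e ∈? X) ×-dec Inc? s v e))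
      λ (v-rep , y , v~y , e , e∈X , ends) → e , v-rep , e∈X , incident v~y ends
    where
    incident : ∀ {v y e} → Same s v y → src e ≡ y ⊎ tgt e ≡ y → Inc s v e
    incident v~y (inj₁ refl) = inj₁ v~y
    incident v~y (inj₂ refl) = inj₂ v~y

  live-edges-bound : ∀ {s} → InForest s → Final s → liveCount s ≤ 4 * count (_∈? X)
  live-edges-bound {s} forest final = ℕₚ.+-cancelʳ-≤ (2 * liveCount s) (liveCount s) (4 * count (_∈? X)) (begin
    3 * liveCount s
      ≤⟨ ℕₚ.*-monoʳ-≤ 3 (live≤nonisolatedReps forest) ⟩
    3 * count (NonIsolatedRep? s)
      ≤⟨ nonisolatedReps-bound final ⟩
    incidences s (Live? s) + 2 * count (TerminalRep? s)
      ≤⟨ ℕₚ.+-mono-≤ (incidences≤ s (Live? s))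
                     (ℕₚ.*-monoʳ-≤ 2 (ℕₚ.≤-trans (terminalReps≤incidences s) (incidences≤ s (_∈? X)))) ⟩
    2 * liveCount s + 2 * (2 * count (_∈? X))
      ≡⟨ ℕₚ.+-comm (2 * liveCount s) _ ⟩
    2 * (2 * count (_∈? X)) + 2 * liveCount s
      ≡⟨ cong (_+ 2 * liveCount s) (ℕₚ.*-assoc 2 2 (count (_∈? X))) ⟨
    4 * count (_∈? X) + 2 * liveCount s ∎)
    where open ℕₚ.≤-Reasoning

  ∣liveSet∣≡liveCount : ∀ s → ∣ liveSet s ∣ ≡ liveCount s
  ∣liveSet∣≡liveCount s =
    trans (∣p∣≡count (liveSet s)) (count-cong (_∈? liveSet s) (Live? s) λ e → to e , from e)
    where
    to : ∀ e → e ∈ liveSet s → Live s e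
    to e e∈ with s e | trans (sym (lookup∘tabulate (λ g → isLive (s g)) e)) ([]=⇒lookup e∈)
    ... | live  | _  = refl
    ... | dead  | ()
    ... | contr | ()
    from : ∀ e → Live s e → e ∈ liveSet s
    from e live-e = lookup⇒[]= e (liveSet s) (trans (lookup∘tabulate (λ g → isLive (s g)) e) (cong isLive live-e))

  size-bound : ∀ {s} → Reduces EndOfX Contract S s → ∣ liveSet s ∣ ≤ 4 * ∣ X ∣
  size-bound {s} (init↠s , final) =
    subst₂ _≤_ (sym (∣liveSet∣≡liveCount s)) (cong (4 *_) (sym (∣p∣≡count X)))
      (live-edges-bound (InForest-↠ InForest-init init↠s) final)

module WeightOrder (O : StrictTotalOrder 0ℓ 0ℓ 0ℓ) {n : ℕ} (w : Fin n → Carrier O)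
                   (w-injective : ∀ e e′ → _≈_ O (w e) (w e′) → e ≡ e′) where

  open StrictTotalOrder O using (compare) renaming (asym to <-asym; trans to <-trans)

  Lighter Heavier : Fin n → Fin n → Set
  Lighter e e′ = _<_ O (w e) (w e′)
  Heavier e e′ = _<_ O (w e′) (w e)

  Lighter-asym : Asymmetric Lighter
  Lighter-asym = <-asym

  Lighter-trans : Transitive Lighter
  Lighter-trans = <-trans

  Lighter-total : ∀ {e e′} → e ≢ e′ → Lighter e e′ ⊎ Lighter e′ e
  Lighter-total {e} {e′} e≢e′ with compare (w e) (w e′)
  ... | tri< e<e′ _ _ = inj₁ e<e′
  ... | tri≈ _ e≈e′ _ = contradiction (w-injective e e′ e≈e′) e≢e′
  ... | tri> _ _ e′<e = inj₂ e′<e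

  Heavier-asym : Asymmetric Heavier
  Heavier-asym = <-asym

  Heavier-trans : Transitive Heavier
  Heavier-trans b<a c<b = <-trans c<b b<a

  Heavier-total : ∀ {e e′} → e ≢ e′ → Heavier e e′ ⊎ Heavier e′ e
  Heavier-total = Sum.swap ∘ Lighter-total

lemma3 : ∃[ c ] ((O : StrictTotalOrder 0ℓ 0ℓ 0ℓ) (M : Map)
           (w : Fin (nE M) → Carrier O) → (∀ e e′ → _≈_ O (w e) (w e′) → e ≡ e′)
           → (T C X : Subset (nE M)) → TreeCotree M T C X
           → ((s : Primal.State M)
                → Primal.Reduces M (TermPrimal M X) (λ e e′ → _<_ O (w e) (w e′)) T s
                → ∣ Primal.liveSet M s ∣ ≤ c * ∣ X ∣)
           × ((s : Dual.State M)
                → Dual.Reduces M (TermDual M X) (λ e e′ → _<_ O (w e′) (w e)) C s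
                → ∣ Dual.liveSet M s ∣ ≤ c * ∣ X ∣)
           × ((s s′ : Primal.State M)
                → Primal.Reduces M (TermPrimal M X) (λ e e′ → _<_ O (w e) (w e′)) T s
                → Primal.Reduces M (TermPrimal M X) (λ e e′ → _<_ O (w e) (w e′)) T s′
                → Primal.SameResult M s s′)
           × ((s s′ : Dual.State M)
                → Dual.Reduces M (TermDual M X) (λ e e′ → _<_ O (w e′) (w e)) C s
                → Dual.Reduces M (TermDual M X) (λ e e′ → _<_ O (w e′) (w e)) C s′
                → Dual.SameResult M s s′))
lemma3 = 4 , λ O M w w-injective T C X (_ , _ , _ , _ , (_ , T-acyclic) , (_ , C-acyclic)) →
  let open WeightOrder O w w-injective in
  (λ _ → Size.size-bound (Map.src M) (Map.tgt M) T T-acyclic X Lighter Lighter-asym Lighter-trans Lighter-total) ,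
  (λ _ → Size.size-bound (Map.dsrc M) (Map.dtgt M) C C-acyclic X Heavier Heavier-asym Heavier-trans Heavier-total) ,
  (λ _ _ → Reduction.reduction-unique (Map.src M) (Map.tgt M) T T-acyclic (TermPrimal M X)
                                      Lighter Lighter-asym Lighter-trans) ,
  (λ _ _ → Reduction.reduction-unique (Map.dsrc M) (Map.dtgt M) C C-acyclic (TermDual M X)
                                      Heavier Heavier-asym Heavier-trans)
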